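{- For all integers $n\geq1$ and $t$, there is a linear program $\mathrm{EX}_{n,t}(x_1,\ldots,x_n,y)$ in the variables $x_1,\ldots,x_n,y$ and additional auxiliary variables such that: (i) its size is polynomial in $n$; (ii) it is symmetric with respect to the group of permutations of $x_1,\ldots,x_n,y$ that fix $y$, i.e., for every permutation $\tau$ of $x_1,\ldots,x_n$ there is a permutation of the auxiliary variables such that applying both (and fixing $y$) maps the set of solutions onto itself; (iii) if $x_1,\ldots,x_n\in\{0,1\}$, then there is a unique $y\in\mathbb{R}$ such that $(x_1,\ldots,x_n,y)$ can be extended to a feasible solution, and this $y$ equals $1$ if $\sum_{k=1}^n x_k=t$ and $0$ otherwise.
   Context: The size of a linear program is (number of variables $+1$)$\times$(number of inequalities)$\times$(maximum number of bits of numerators and denominators of its coefficients and constant terms).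
   Formalization: The variables $x_1,\ldots,x_n,y$ and the auxiliary variables take values in ℚ rather than ℝ, so the solution set, its symmetry and the unique y are taken over ℚ. -}

module Defs where

open import Data.Nat as ℕ using (ℕ; zero; suc; _⊔_)
open import Data.Nat.Logarithm using (⌊log₂_⌋)
open import Data.Integer as ℤ using (ℤ)
open import Data.Rational using (ℚ; 0ℚ; 1ℚ; _+_; _*_; _≤_; ↥_; ↧ₙ_)
open import Data.Fin using (Fin; zero; suc)
open import Data.Product using (Σ; _×_)

sumℚ : {k : ℕ} → (Fin k → ℚ) → ℚ
sumℚ {zero}  f = 0ℚ
sumℚ {suc k} f = f zero + sumℚ (λ i → f (suc i))

maxF : {k : ℕ} → (Fin k → ℕ) → ℕ
maxF {zero}  f = 0
maxF {suc k} f = f zero ⊔ maxF (λ i → f (suc i))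

bits : ℕ → ℕ
bits zero    = 1
bits (suc m) = suc ⌊log₂ suc m ⌋

bitsℚ : ℚ → ℕ
bitsℚ q = bits ℤ.∣ ↥ q ∣ ⊔ bits (↧ₙ q)

-- A linear program with variables x₁..xₙ, y and a auxiliary variables
-- w₁..wₐ, consisting of r inequalities
--   Σⱼ xcoef i j * xⱼ + ycoef i * y + Σₖ wcoef i k * wₖ ≤ rhs i .
record LP (n a r : ℕ) : Set where
  field
    xcoef : Fin r → Fin n → ℚ
    ycoef : Fin r → ℚ
    wcoef : Fin r → Fin a → ℚ
    rhs   : Fin r → ℚ
open LP public

maxBits : {n a r : ℕ} → LP n a r → ℕ
maxBits L = maxF (λ i →
  maxF (λ j → bitsℚ (xcoef L i j)) ⊔ bitsℚ (ycoef L i) ⊔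
  maxF (λ k → bitsℚ (wcoef L i k)) ⊔ bitsℚ (rhs L i))

size : {n a r : ℕ} → LP n a r → ℕ
size {n} {a} {r} L = (n ℕ.+ 1 ℕ.+ a ℕ.+ 1) ℕ.* r ℕ.* maxBits L

Feasible : {n a r : ℕ} → LP n a r → (Fin n → ℚ) → ℚ → (Fin a → ℚ) → Set
Feasible L x y w = ∀ i →
  sumℚ (λ j → xcoef L i j * x j) + ycoef L i * y + sumℚ (λ k → wcoef L i k * w k)
    ≤ rhs L i

Extendable : {n a r : ℕ} → LP n a r → (Fin n → ℚ) → ℚ → Set
Extendable {a = a} L x y = Σ (Fin a → ℚ) (λ w → Feasible L x y w)

{-# OPTIONS --safe #-}
module Submission where

-- EX is the disjunctive formulation of the convex hull of the points (x, [Σx = t]), x ∈ {0,1}ⁿ,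
-- split by the level k = Σx ∈ {0, …, n}: weights μₖ with Σₖ μₖ = 1 and parts zₖ ∈ μₖ·[0,1]ⁿ
-- with Σⱼ zₖⱼ = k μₖ and x = Σₖ zₖ, the output being y = Σ_{k = t} μₖ.
-- For 0/1-valued x every part is forced to be zₖⱼ = xⱼ μₖ: a column with xⱼ = 0 is non-negative
-- with sum 0, and one with xⱼ = 1 is bounded by μ and has the same sum 1. Hence (k − Σx) μₖ = 0,
-- all weight sits on the level Σx, and y = [Σx = t].
-- Permuting the coordinates of x together with the columns of z maps the program to itself, and
-- every coefficient is an integer of absolute value at most 2(n + 1), so the size is O(n⁵).

open import Defs
open import Algebra.Bundles using (CommutativeRing)
import Algebra.Properties.Semiring.Sum as SemiringSum
open import Data.Bool.Base using (if_then_else_)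
open import Data.Empty using (⊥-elim)
open import Data.Fin as Fin using (Fin; zero; suc; toℕ; combine; remQuot; fromℕ<)
import Data.Fin.Properties as Finₚ
open import Data.Fin.Patterns using (0F; 1F; 2F; 3F; 4F; 5F; 6F; 7F; 8F; 9F)
open import Data.Fin.Permutation as Perm using (Permutation′; _⟨$⟩ʳ_; lift₀)
open import Data.Integer as ℤ using (ℤ)
import Data.Integer.Properties as ℤₚ
open import Data.Nat as ℕ using (ℕ; zero; suc)
import Data.Nat.Properties as ℕₚ
open import Data.Nat.Logarithm using (⌊log₂_⌋; ⌊log₂⌋-mono-≤; ⌊log₂[2^n]⌋≡n)
open import Data.Nat.Tactic.RingSolver using (solve-∀)
open import Data.Product using (Σ; _×_; _,_; proj₁; proj₂)
open import Data.Product.Function.NonDependent.Propositional using (_×-↔_)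
open import Data.Rational
  using (ℚ; 0ℚ; 1ℚ; _+_; _*_; _-_; -_; _≤_; _<_; _/_; ↥_; 1/_; ≢-nonZero; *≤*)
open import Data.Rational.Literals using (fromℤ)
open import Data.Rational.Properties
open import Data.Rational.Solver using (module +-*-Solver)
open import Data.Rational.Unnormalised.Base using (*≡*)
import Data.Rational.Unnormalised.Properties as ℚᵘ
open import Data.Sum using (_⊎_; inj₁; inj₂)
open import Function using (_∘_; _⇔_; mk⇔; Equivalence; _↔_; Inverse)
open import Function.Construct.Composition using (_↔-∘_; _⇔-∘_)
open import Function.Construct.Identity using (↔-id)
open import Function.Construct.Symmetry using (↔-sym)
open import Relation.Nullary using (Dec; does; yes; no; ¬_)
open import Relation.Binary.PropositionalEquality

open Equivalence using (to; from)
open +-*-Solver using (solve; _:+_; _:*_; _:-_; :-_; _:=_; con)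

private variable
  k n a r B C : ℕ

fromℤ-+ : ∀ i j → fromℤ (i ℤ.+ j) ≡ fromℤ i + fromℤ j
fromℤ-+ i j =
  toℚᵘ-injective (ℚᵘ.≃-trans (*≡* eq) (ℚᵘ.≃-sym (toℚᵘ-homo-+ (fromℤ i) (fromℤ j))))
  where
  eq : (i ℤ.+ j) ℤ.* ℤ.+ 1 ≡ (i ℤ.* ℤ.+ 1 ℤ.+ j ℤ.* ℤ.+ 1) ℤ.* ℤ.+ 1
  eq = cong (ℤ._* ℤ.+ 1) (sym (cong₂ ℤ._+_ (ℤₚ.*-identityʳ i) (ℤₚ.*-identityʳ j)))

fromℤ-* : ∀ i j → fromℤ (i ℤ.* j) ≡ fromℤ i * fromℤ j
fromℤ-* i j =
  toℚᵘ-injective (ℚᵘ.≃-trans (*≡* refl) (ℚᵘ.≃-sym (toℚᵘ-homo-* (fromℤ i) (fromℤ j))))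

fromℤ-neg : ∀ i → fromℤ (ℤ.- i) ≡ - fromℤ i
fromℤ-neg ℤ.-[1+ _ ] = refl
fromℤ-neg (ℤ.+ zero)  = refl
fromℤ-neg (ℤ.+ suc _) = refl

fromℤ-injective : ∀ {i j} → fromℤ i ≡ fromℤ j → i ≡ j
fromℤ-injective = cong ↥_

fromℤ≡/1 : ∀ i → fromℤ i ≡ i / 1
fromℤ≡/1 i = sym (↥p/↧p≡p (fromℤ i))

private module Sum = SemiringSum (CommutativeRing.semiring +-*-commutativeRing)

sumℚ≡sum : (f : Fin k → ℚ) → sumℚ f ≡ Sum.sum f
sumℚ≡sum {zero}  f = refl
sumℚ≡sum {suc k} f = cong (f zero +_) (sumℚ≡sum (f ∘ suc))

sumℚ-cong : {f g : Fin k → ℚ} → (∀ i → f i ≡ g i) → sumℚ f ≡ sumℚ g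
sumℚ-cong {zero}  f≗g = refl
sumℚ-cong {suc k} f≗g = cong₂ _+_ (f≗g zero) (sumℚ-cong (f≗g ∘ suc))

sumℚ-zero : ∀ k → sumℚ {k} (λ _ → 0ℚ) ≡ 0ℚ
sumℚ-zero k = trans (sumℚ≡sum {k} (λ _ → 0ℚ)) (Sum.sum-replicate-zero k)

sumℚ-+ : (f g : Fin k → ℚ) → sumℚ (λ i → f i + g i) ≡ sumℚ f + sumℚ g
sumℚ-+ f g = trans (sumℚ≡sum (λ i → f i + g i))
  (trans (Sum.∑-distrib-+ f g) (sym (cong₂ _+_ (sumℚ≡sum f) (sumℚ≡sum g))))

sumℚ-*ˡ : ∀ p (f : Fin k → ℚ) → sumℚ (λ i → p * f i) ≡ p * sumℚ f
sumℚ-*ˡ p f = trans (sumℚ≡sum (λ i → p * f i))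
  (trans (sym (Sum.*-distribˡ-sum p f)) (cong (p *_) (sym (sumℚ≡sum f))))

sumℚ-*ʳ : ∀ p (f : Fin k → ℚ) → sumℚ (λ i → f i * p) ≡ sumℚ f * p
sumℚ-*ʳ p f = trans (sumℚ≡sum (λ i → f i * p))
  (trans (sym (Sum.*-distribʳ-sum p f)) (cong (_* p) (sym (sumℚ≡sum f))))

sumℚ-permute : (π : Permutation′ k) (f : Fin k → ℚ) → sumℚ (λ i → f (π ⟨$⟩ʳ i)) ≡ sumℚ f
sumℚ-permute π f = trans (sumℚ≡sum (λ i → f (π ⟨$⟩ʳ i)))
  (trans (sym (Sum.sum-permute f π)) (sym (sumℚ≡sum f)))

sumℚ-supported : (f : Fin k → ℚ) (i : Fin k) → (∀ j → j ≢ i → f j ≡ 0ℚ) → sumℚ f ≡ f i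
sumℚ-supported {suc k} f zero    f≡0 = begin
  f zero + sumℚ (f ∘ suc)       ≡⟨ cong (f zero +_) (sumℚ-cong λ j → f≡0 (suc j) λ ()) ⟩
  f zero + sumℚ {k} (λ _ → 0ℚ) ≡⟨ cong (f zero +_) (sumℚ-zero k) ⟩
  f zero + 0ℚ                   ≡⟨ +-identityʳ (f zero) ⟩
  f zero                        ∎
  where open ≡-Reasoning
sumℚ-supported {suc k} f (suc i) f≡0 = begin
  f zero + sumℚ (f ∘ suc) ≡⟨ cong (_+ sumℚ (f ∘ suc)) (f≡0 zero λ ()) ⟩
  0ℚ + sumℚ (f ∘ suc)     ≡⟨ +-identityˡ (sumℚ (f ∘ suc)) ⟩
  sumℚ (f ∘ suc)          ≡⟨ sumℚ-supported (f ∘ suc) i (λ j j≢i →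
                               f≡0 (suc j) (j≢i ∘ Finₚ.suc-injective)) ⟩
  f (suc i)               ∎
  where open ≡-Reasoning

sumℚ-mono-≤ : {f g : Fin k → ℚ} → (∀ i → f i ≤ g i) → sumℚ f ≤ sumℚ g
sumℚ-mono-≤ {zero}  f≤g = ≤-refl
sumℚ-mono-≤ {suc k} f≤g = +-mono-≤ (f≤g zero) (sumℚ-mono-≤ (f≤g ∘ suc))

sumℚ-mono-< : {f g : Fin k → ℚ} → (∀ i → f i ≤ g i) → ∀ i → f i < g i → sumℚ f < sumℚ g
sumℚ-mono-< f≤g zero    f<g = +-mono-<-≤ f<g (sumℚ-mono-≤ (f≤g ∘ suc))
sumℚ-mono-< f≤g (suc i) f<g = +-mono-≤-< (f≤g zero) (sumℚ-mono-< (f≤g ∘ suc) i f<g)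

≤-pointwise∧sum-≥⇒≡ : {f g : Fin k → ℚ} → (∀ i → f i ≤ g i) → sumℚ g ≤ sumℚ f → ∀ i → f i ≡ g i
≤-pointwise∧sum-≥⇒≡ f≤g Σg≤Σf i = ≤-antisym (f≤g i) (≮⇒≥ λ f<g →
  <-irrefl refl (<-≤-trans (sumℚ-mono-< f≤g i f<g) Σg≤Σf))

𝟙 : {P : Set} → Dec P → ℤ
𝟙 P? = if does P? then ℤ.1ℤ else ℤ.0ℤ

𝟙-yes : {P : Set} (P? : Dec P) → P → 𝟙 P? ≡ ℤ.1ℤ
𝟙-yes (yes _) _ = refl
𝟙-yes (no ¬p) p = ⊥-elim (¬p p)

𝟙-no : {P : Set} (P? : Dec P) → ¬ P → 𝟙 P? ≡ ℤ.0ℤ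
𝟙-no (yes p) ¬p = ⊥-elim (¬p p)
𝟙-no (no _)  _  = refl

∣𝟙∣≤1 : {P : Set} (P? : Dec P) → ℤ.∣ 𝟙 P? ∣ ℕ.≤ 1
∣𝟙∣≤1 (yes _) = ℕₚ.≤-refl
∣𝟙∣≤1 (no _)  = ℕ.z≤n

0≤𝟙 : {P : Set} (P? : Dec P) → 0ℚ ≤ fromℤ (𝟙 P?)
0≤𝟙 (yes _) = *≤* (ℤ.+≤+ ℕ.z≤n)
0≤𝟙 (no _)  = ≤-refl

δ : Fin k → Fin k → ℤ
δ i j = 𝟙 (i Finₚ.≟ j)

sumℚ-δ : (i : Fin k) (f : Fin k → ℚ) → sumℚ (λ j → fromℤ (δ i j) * f j) ≡ f i
sumℚ-δ i f = begin
  sumℚ (λ j → fromℤ (δ i j) * f j) ≡⟨ sumℚ-supported _ i off-diagonal ⟩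
  fromℤ (δ i i) * f i              ≡⟨ cong (λ c → fromℤ c * f i) (𝟙-yes (i Finₚ.≟ i) refl) ⟩
  1ℚ * f i                         ≡⟨ *-identityˡ (f i) ⟩
  f i                              ∎
  where
  open ≡-Reasoning
  off-diagonal : ∀ j → j ≢ i → fromℤ (δ i j) * f j ≡ 0ℚ
  off-diagonal j j≢i =
    trans (cong (λ c → fromℤ c * f j) (𝟙-no (i Finₚ.≟ j) (j≢i ∘ sym))) (*-zeroˡ (f j))

δ-*-comm : (f : Fin k → ℤ) (i j : Fin k) → δ i j ℤ.* f i ≡ f j ℤ.* δ i j
δ-*-comm f i j with i Finₚ.≟ j
... | yes refl = ℤₚ.*-comm ℤ.1ℤ (f i)
... | no _     = sym (ℤₚ.*-zeroʳ (f j))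

*-cancelʳ-≢ : ∀ {p q} r → p ≢ q → p * r ≡ q * r → r ≡ 0ℚ
*-cancelʳ-≢ {p} {q} r p≢q pr≡qr = begin
  r                          ≡⟨ sym (*-identityˡ r) ⟩
  1ℚ * r                     ≡⟨ cong (_* r) (sym (*-inverseˡ (p - q))) ⟩
  1/ (p - q) * (p - q) * r   ≡⟨ *-assoc (1/ (p - q)) (p - q) r ⟩
  1/ (p - q) * ((p - q) * r) ≡⟨ cong (1/ (p - q) *_) [p-q]r≡0 ⟩
  1/ (p - q) * 0ℚ            ≡⟨ *-zeroʳ (1/ (p - q)) ⟩
  0ℚ                         ∎
  where
  open ≡-Reasoning
  p-q≢0 : p - q ≢ 0ℚ
  p-q≢0 p-q≡0 = p≢q (trans (solve 2 (λ p q → p := p :- q :+ q) refl p q)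
                           (trans (cong (_+ q) p-q≡0) (+-identityˡ q)))
  instance
    p-q-nonZero = ≢-nonZero p-q≢0
  [p-q]r≡0 : (p - q) * r ≡ 0ℚ
  [p-q]r≡0 = trans (solve 3 (λ p q r → (p :- q) :* r := p :* r :- q :* r) refl p q r)
                   (trans (cong (_- q * r) pr≡qr) (+-inverseʳ (q * r)))

≤⇔-≤0 : ∀ {p q} → p ≤ q ⇔ p - q ≤ 0ℚ
≤⇔-≤0 {p} {q} = mk⇔
  (λ p≤q → subst (p - q ≤_) (+-inverseʳ q) (+-monoˡ-≤ (- q) p≤q))
  (λ p-q≤0 → subst₂ _≤_ (solve 2 (λ p q → p :- q :+ q := p) refl p q) (+-identityˡ q)
                        (+-monoˡ-≤ q p-q≤0))

Bit : ℚ → Set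
Bit q = q ≡ 0ℚ ⊎ q ≡ 1ℚ

Binary : (Fin n → ℚ) → Set
Binary x = ∀ j → Bit (x j)

0≤*-Bit : ∀ {p b} → 0ℚ ≤ p → Bit b → 0ℚ ≤ p * b
0≤*-Bit {p} 0≤p (inj₁ refl) = ≤-reflexive (sym (*-zeroʳ p))
0≤*-Bit {p} 0≤p (inj₂ refl) = subst (0ℚ ≤_) (sym (*-identityʳ p)) 0≤p

*-Bit-≤ : ∀ {p b} → 0ℚ ≤ p → Bit b → p * b ≤ p
*-Bit-≤ {p} 0≤p (inj₁ refl) = subst (_≤ p) (sym (*-zeroʳ p)) 0≤p
*-Bit-≤ {p} 0≤p (inj₂ refl) = ≤-reflexive (*-identityʳ p)

binary-sum : (x : Fin n → ℚ) → Binary x → Σ (Fin (suc n)) λ m → sumℚ x ≡ fromℤ (ℤ.+ toℕ m)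
binary-sum {zero}  x bin = zero , refl
binary-sum {suc n} x bin with binary-sum (x ∘ suc) (bin ∘ suc) | bin zero
... | m , Σ≡m | inj₁ x₀≡0 = Fin.inject₁ m , (begin
  x zero + sumℚ (x ∘ suc)         ≡⟨ cong₂ _+_ x₀≡0 Σ≡m ⟩
  0ℚ + fromℤ (ℤ.+ toℕ m)          ≡⟨ +-identityˡ (fromℤ (ℤ.+ toℕ m)) ⟩
  fromℤ (ℤ.+ toℕ m)               ≡⟨ cong (λ i → fromℤ (ℤ.+ i)) (sym (Finₚ.toℕ-inject₁ m)) ⟩
  fromℤ (ℤ.+ toℕ (Fin.inject₁ m)) ∎)
  where open ≡-Reasoning
... | m , Σ≡m | inj₂ x₀≡1 = suc m , (begin
  x zero + sumℚ (x ∘ suc) ≡⟨ cong₂ _+_ x₀≡1 Σ≡m ⟩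
  1ℚ + fromℤ (ℤ.+ toℕ m)  ≡⟨ sym (fromℤ-+ ℤ.1ℤ (ℤ.+ toℕ m)) ⟩
  fromℤ (ℤ.+ suc (toℕ m)) ∎)
  where open ≡-Reasoning

data Var (n a : ℕ) : Set where
  xᵛ : Fin n → Var n a
  yᵛ : Var n a
  wᵛ : Fin a → Var n a
  1ᵛ : Var n a

-- Integer coefficients of x, y, w and, at 1ᵛ, the constant term.
Form : ℕ → ℕ → Set
Form n a = Var n a → ℤ

dot : (Fin k → ℤ) → (Fin k → ℚ) → ℚ
dot c v = sumℚ (λ i → fromℤ (c i) * v i)

linear : Form n a → (Fin n → ℚ) → ℚ → (Fin a → ℚ) → ℚ
linear F x y w = dot (F ∘ xᵛ) x + fromℤ (F yᵛ) * y + dot (F ∘ wᵛ) w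

⟦_⟧ : Form n a → (Fin n → ℚ) → ℚ → (Fin a → ℚ) → ℚ
⟦ F ⟧ x y w = linear F x y w + fromℤ (F 1ᵛ)

infixl 6 _⊕_
infixr 7 _·_

0ᶠ : Form n a
0ᶠ _ = ℤ.0ℤ

_⊕_ : Form n a → Form n a → Form n a
(F ⊕ G) v = F v ℤ.+ G v

_·_ : ℤ → Form n a → Form n a
(c · F) v = c ℤ.* F v

∑ : (Fin k → Form n a) → Form n a
∑ {zero}  F = 0ᶠ
∑ {suc k} F = F zero ⊕ ∑ (F ∘ suc)

X : Fin n → Form n a
X j (xᵛ j′) = δ j j′
X j yᵛ      = ℤ.0ℤ
X j (wᵛ _)  = ℤ.0ℤ
X j 1ᵛ      = ℤ.0ℤ

Y : Form n a
Y (xᵛ _) = ℤ.0ℤ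
Y yᵛ     = ℤ.1ℤ
Y (wᵛ _) = ℤ.0ℤ
Y 1ᵛ     = ℤ.0ℤ

W : Fin a → Form n a
W p (xᵛ _)  = ℤ.0ℤ
W p yᵛ      = ℤ.0ℤ
W p (wᵛ p′) = δ p p′
W p 1ᵛ      = ℤ.0ℤ

𝟏 : Form n a
𝟏 (xᵛ _) = ℤ.0ℤ
𝟏 yᵛ     = ℤ.0ℤ
𝟏 (wᵛ _) = ℤ.0ℤ
𝟏 1ᵛ     = ℤ.1ℤ

dot-0 : (v : Fin k → ℚ) → dot (λ _ → ℤ.0ℤ) v ≡ 0ℚ
dot-0 v = trans (sumℚ-*ˡ 0ℚ v) (*-zeroˡ (sumℚ v))

dot-+ : (c d : Fin k → ℤ) (v : Fin k → ℚ) → dot (λ i → c i ℤ.+ d i) v ≡ dot c v + dot d v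
dot-+ c d v = trans
  (sumℚ-cong λ i → trans (cong (_* v i) (fromℤ-+ (c i) (d i)))
                         (*-distribʳ-+ (v i) (fromℤ (c i)) (fromℤ (d i))))
  (sumℚ-+ (λ i → fromℤ (c i) * v i) (λ i → fromℤ (d i) * v i))

dot-* : (s : ℤ) (c : Fin k → ℤ) (v : Fin k → ℚ) → dot (λ i → s ℤ.* c i) v ≡ fromℤ s * dot c v
dot-* s c v = trans
  (sumℚ-cong λ i → trans (cong (_* v i) (fromℤ-* s (c i))) (*-assoc (fromℤ s) (fromℤ (c i)) (v i)))
  (sumℚ-*ˡ (fromℤ s) (λ i → fromℤ (c i) * v i))

module _ (x : Fin n → ℚ) (y : ℚ) (w : Fin a → ℚ) where

  ⟦0ᶠ⟧ : ⟦ 0ᶠ ⟧ x y w ≡ 0ℚ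
  ⟦0ᶠ⟧ = trans (cong₂ (λ p q → p + 0ℚ * y + q + 0ℚ) (dot-0 x) (dot-0 w))
    (solve 1 (λ y → con 0ℚ :+ con 0ℚ :* y :+ con 0ℚ :+ con 0ℚ := con 0ℚ) refl y)

  ⟦⊕⟧ : (F G : Form n a) → ⟦ F ⊕ G ⟧ x y w ≡ ⟦ F ⟧ x y w + ⟦ G ⟧ x y w
  ⟦⊕⟧ F G = trans
    (cong₂ _+_ (cong₂ _+_ (cong₂ _+_ (dot-+ (F ∘ xᵛ) (G ∘ xᵛ) x)
                                      (cong (_* y) (fromℤ-+ (F yᵛ) (G yᵛ))))
                          (dot-+ (F ∘ wᵛ) (G ∘ wᵛ) w))
               (fromℤ-+ (F 1ᵛ) (G 1ᵛ)))
    (solve 9 (λ a a′ b b′ y c c′ d d′ →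
        (a :+ a′) :+ (b :+ b′) :* y :+ (c :+ c′) :+ (d :+ d′)
      := (a :+ b :* y :+ c :+ d) :+ (a′ :+ b′ :* y :+ c′ :+ d′)) refl
      (dot (F ∘ xᵛ) x) (dot (G ∘ xᵛ) x) (fromℤ (F yᵛ)) (fromℤ (G yᵛ)) y
      (dot (F ∘ wᵛ) w) (dot (G ∘ wᵛ) w) (fromℤ (F 1ᵛ)) (fromℤ (G 1ᵛ)))

  ⟦·⟧ : (s : ℤ) (F : Form n a) → ⟦ s · F ⟧ x y w ≡ fromℤ s * ⟦ F ⟧ x y w
  ⟦·⟧ s F = trans
    (cong₂ _+_ (cong₂ _+_ (cong₂ _+_ (dot-* s (F ∘ xᵛ) x) (cong (_* y) (fromℤ-* s (F yᵛ))))
                          (dot-* s (F ∘ wᵛ) w))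
               (fromℤ-* s (F 1ᵛ)))
    (solve 6 (λ s a b y c d → s :* a :+ s :* b :* y :+ s :* c :+ s :* d
                            := s :* (a :+ b :* y :+ c :+ d)) refl
      (fromℤ s) (dot (F ∘ xᵛ) x) (fromℤ (F yᵛ)) y (dot (F ∘ wᵛ) w) (fromℤ (F 1ᵛ)))

  ⟦∑⟧ : (F : Fin k → Form n a) → ⟦ ∑ F ⟧ x y w ≡ sumℚ (λ i → ⟦ F i ⟧ x y w)
  ⟦∑⟧ {zero}  F = ⟦0ᶠ⟧
  ⟦∑⟧ {suc k} F =
    trans (⟦⊕⟧ (F zero) (∑ (F ∘ suc))) (cong (⟦ F zero ⟧ x y w +_) (⟦∑⟧ (F ∘ suc)))

  ⟦X⟧ : ∀ j → ⟦ X j ⟧ x y w ≡ x j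
  ⟦X⟧ j = trans (cong₂ (λ p q → p + 0ℚ * y + q + 0ℚ) (sumℚ-δ j x) (dot-0 w))
    (solve 2 (λ x y → x :+ con 0ℚ :* y :+ con 0ℚ :+ con 0ℚ := x) refl (x j) y)

  ⟦Y⟧ : ⟦ Y ⟧ x y w ≡ y
  ⟦Y⟧ = trans (cong₂ (λ p q → p + 1ℚ * y + q + 0ℚ) (dot-0 x) (dot-0 w))
    (solve 1 (λ y → con 0ℚ :+ con 1ℚ :* y :+ con 0ℚ :+ con 0ℚ := y) refl y)

  ⟦W⟧ : ∀ p → ⟦ W p ⟧ x y w ≡ w p
  ⟦W⟧ p = trans (cong₂ (λ q r → q + 0ℚ * y + r + 0ℚ) (dot-0 x) (sumℚ-δ p w))
    (solve 2 (λ y w → con 0ℚ :+ con 0ℚ :* y :+ w :+ con 0ℚ := w) refl y (w p))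

  ⟦𝟏⟧ : ⟦ 𝟏 ⟧ x y w ≡ 1ℚ
  ⟦𝟏⟧ = trans (cong₂ (λ p q → p + 0ℚ * y + q + 1ℚ) (dot-0 x) (dot-0 w))
    (solve 1 (λ y → con 0ℚ :+ con 0ℚ :* y :+ con 0ℚ :+ con 1ℚ := con 1ℚ) refl y)

infix 4 _≼_

data Inequality (n a : ℕ) : Set where
  _≼_ : Form n a → Form n a → Inequality n a

-- A data type rather than a function, so that P and Q can be read off Holds (P ≼ Q) by unification.
data Holds {n a} : Inequality n a → (Fin n → ℚ) → ℚ → (Fin a → ℚ) → Set where
  holds : ∀ {P Q x y w} → ⟦ P ⟧ x y w ≤ ⟦ Q ⟧ x y w → Holds (P ≼ Q) x y w

difference : Inequality n a → Form n a
difference (P ≼ Q) = P ⊕ ℤ.-1ℤ · Q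

-- Row i is  difference (I i) ≤ 0  with the constant term moved to the right-hand side.
system : (Fin r → Inequality n a) → LP n a r
system I = record
  { xcoef = λ i j → fromℤ (difference (I i) (xᵛ j))
  ; ycoef = λ i → fromℤ (difference (I i) yᵛ)
  ; wcoef = λ i p → fromℤ (difference (I i) (wᵛ p))
  ; rhs   = λ i → fromℤ (ℤ.- difference (I i) 1ᵛ)
  }

module _ (x : Fin n → ℚ) (y : ℚ) (w : Fin a → ℚ) where

  row⇔holds : (I : Inequality n a) →
    linear (difference I) x y w ≤ fromℤ (ℤ.- difference I 1ᵛ) ⇔ Holds I x y w
  row⇔holds I@(P ≼ Q) = mk⇔
    (λ row → holds (from ≤⇔-≤0 (subst (_≤ 0ℚ) gap (to ≤⇔-≤0 row))))
    (λ { (holds P≤Q) → from ≤⇔-≤0 (subst (_≤ 0ℚ) (sym gap) (to ≤⇔-≤0 P≤Q)) })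
    where
    open ≡-Reasoning
    L = linear (difference I) x y w
    c = fromℤ (difference I 1ᵛ)
    gap : L - fromℤ (ℤ.- difference I 1ᵛ) ≡ ⟦ P ⟧ x y w - ⟦ Q ⟧ x y w
    gap = begin
      L - fromℤ (ℤ.- difference I 1ᵛ)  ≡⟨ cong (λ d → L - d) (fromℤ-neg (difference I 1ᵛ)) ⟩
      L - (- c)                         ≡⟨ solve 2 (λ L c → L :- (:- c) := L :+ c) refl L c ⟩
      ⟦ difference I ⟧ x y w            ≡⟨ ⟦⊕⟧ x y w P (ℤ.-1ℤ · Q) ⟩
      ⟦ P ⟧ x y w + ⟦ ℤ.-1ℤ · Q ⟧ x y w ≡⟨ cong (⟦ P ⟧ x y w +_) (⟦·⟧ x y w ℤ.-1ℤ Q) ⟩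
      ⟦ P ⟧ x y w + - 1ℚ * ⟦ Q ⟧ x y w  ≡⟨ solve 2 (λ p q → p :+ con (- 1ℚ) :* q := p :- q) refl
                                             (⟦ P ⟧ x y w) (⟦ Q ⟧ x y w) ⟩
      ⟦ P ⟧ x y w - ⟦ Q ⟧ x y w         ∎

  feasible⇔holds : (I : Fin r → Inequality n a) →
    Feasible (system I) x y w ⇔ (∀ i → Holds (I i) x y w)
  feasible⇔holds I = mk⇔
    (λ feasible i → to (row⇔holds (I i)) (feasible i))
    (λ H i → from (row⇔holds (I i)) (H i))

∀-↔ : {A B : Set} {P : B → Set} (e : A ↔ B) → (∀ a → P (Inverse.to e a)) ⇔ (∀ b → P b)
∀-↔ {P = P} e = mk⇔
  (λ h b → subst P (Inverse.strictlyInverseˡ e b) (h (Inverse.from e b)))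
  (λ h a → h (Inverse.to e a))

record Bounded (B : ℕ) (F : Form n a) : Set where
  constructor bounded
  field ∣coefficient∣≤ : ∀ v → ℤ.∣ F v ∣ ℕ.≤ B
open Bounded

Bounded-mono : {F : Form n a} → B ℕ.≤ C → Bounded B F → Bounded C F
Bounded-mono B≤C bF = bounded λ v → ℕₚ.≤-trans (∣coefficient∣≤ bF v) B≤C

Bounded-⊕ : {F G : Form n a} → Bounded B F → Bounded C G → Bounded (B ℕ.+ C) (F ⊕ G)
Bounded-⊕ {F = F} {G} bF bG = bounded λ v → ℕₚ.≤-trans (ℤₚ.∣i+j∣≤∣i∣+∣j∣ (F v) (G v))
  (ℕₚ.+-mono-≤ (∣coefficient∣≤ bF v) (∣coefficient∣≤ bG v))

Bounded-· : ∀ s {F : Form n a} → Bounded B F → Bounded (ℤ.∣ s ∣ ℕ.* B) (s · F)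
Bounded-· s {F} bF = bounded λ v → subst (ℕ._≤ _) (sym (ℤₚ.∣i*j∣≡∣i∣*∣j∣ s (F v)))
  (ℕₚ.*-monoʳ-≤ ℤ.∣ s ∣ (∣coefficient∣≤ bF v))

Bounded-∑ : {F : Fin k → Form n a} → (∀ i → Bounded B (F i)) → Bounded (k ℕ.* B) (∑ F)
Bounded-∑ {zero}  bF = bounded λ _ → ℕ.z≤n
Bounded-∑ {suc k} bF = Bounded-⊕ (bF zero) (Bounded-∑ (bF ∘ suc))

Bounded-∑₁ : {F : Fin k → Form n a} → (∀ i → Bounded 1 (F i)) → Bounded k (∑ F)
Bounded-∑₁ {k} bF = Bounded-mono (ℕₚ.≤-reflexive (ℕₚ.*-identityʳ k)) (Bounded-∑ bF)

Bounded-difference : {P Q : Form n a} → Bounded B P → Bounded C Q →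
  Bounded (B ℕ.+ C) (difference (P ≼ Q))
Bounded-difference {B = B} {C} bP bQ =
  Bounded-mono (ℕₚ.≤-reflexive (cong (B ℕ.+_) (ℕₚ.*-identityˡ C)))
               (Bounded-⊕ bP (Bounded-· ℤ.-1ℤ bQ))

Bounded-0ᶠ : Bounded 0 (0ᶠ {n = n} {a = a})
Bounded-0ᶠ = bounded λ _ → ℕ.z≤n

Bounded-X : (j : Fin n) → Bounded 1 (X {a = a} j)
Bounded-X j = bounded λ where
  (xᵛ j′) → ∣𝟙∣≤1 (j Finₚ.≟ j′)
  yᵛ      → ℕ.z≤n
  (wᵛ _)  → ℕ.z≤n
  1ᵛ      → ℕ.z≤n

Bounded-Y : Bounded 1 (Y {n = n} {a = a})
Bounded-Y = bounded λ where
  (xᵛ _) → ℕ.z≤n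
  yᵛ     → ℕₚ.≤-refl
  (wᵛ _) → ℕ.z≤n
  1ᵛ     → ℕ.z≤n

Bounded-W : (p : Fin a) → Bounded 1 (W {n = n} p)
Bounded-W p = bounded λ where
  (xᵛ _)  → ℕ.z≤n
  yᵛ      → ℕ.z≤n
  (wᵛ p′) → ∣𝟙∣≤1 (p Finₚ.≟ p′)
  1ᵛ      → ℕ.z≤n

Bounded-𝟏 : Bounded 1 (𝟏 {n = n} {a = a})
Bounded-𝟏 = bounded λ where
  (xᵛ _) → ℕ.z≤n
  yᵛ     → ℕ.z≤n
  (wᵛ _) → ℕ.z≤n
  1ᵛ     → ℕₚ.≤-refl

n<2^n : ∀ m → m ℕ.< 2 ℕ.^ m
n<2^n zero    = ℕₚ.≤-refl
n<2^n (suc m) = ℕₚ.+-mono-≤ (ℕₚ.m^n>0 2 m) (ℕₚ.≤-trans (n<2^n m) (ℕₚ.m≤m+n _ 0))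

bits≤1+ : ∀ m → bits m ℕ.≤ suc m
bits≤1+ zero    = ℕₚ.≤-refl
bits≤1+ (suc m) = ℕ.s≤s (begin
  ⌊log₂ suc m ⌋       ≤⟨ ⌊log₂⌋-mono-≤ (ℕₚ.<⇒≤ (n<2^n (suc m))) ⟩
  ⌊log₂ 2 ℕ.^ suc m ⌋ ≡⟨ ⌊log₂[2^n]⌋≡n (suc m) ⟩
  suc m               ∎)
  where open ℕₚ.≤-Reasoning

bitsℚ-fromℤ : ∀ i → bitsℚ (fromℤ i) ℕ.≤ suc ℤ.∣ i ∣
bitsℚ-fromℤ i = ℕₚ.⊔-lub (bits≤1+ ℤ.∣ i ∣) (ℕ.s≤s ℕ.z≤n)

maxF-lub : (f : Fin k → ℕ) → (∀ i → f i ℕ.≤ B) → maxF f ℕ.≤ B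
maxF-lub {zero}  f f≤B = ℕ.z≤n
maxF-lub {suc k} f f≤B = ℕₚ.⊔-lub (f≤B zero) (maxF-lub (f ∘ suc) (f≤B ∘ suc))

maxBits-system : (I : Fin r → Inequality n a) → (∀ i → Bounded B (difference (I i))) →
  maxBits (system I) ℕ.≤ suc B
maxBits-system I bI = maxF-lub _ λ i →
  let D = difference (I i)
      coefficient v = ℕₚ.≤-trans (bitsℚ-fromℤ (D v)) (ℕ.s≤s (∣coefficient∣≤ (bI i) v))
      constant = ℕₚ.≤-trans (bitsℚ-fromℤ (ℤ.- D 1ᵛ))
        (ℕ.s≤s (subst (ℕ._≤ _) (sym (ℤₚ.∣-i∣≡∣i∣ (D 1ᵛ))) (∣coefficient∣≤ (bI i) 1ᵛ)))
  in ℕₚ.⊔-lub (ℕₚ.⊔-lub (ℕₚ.⊔-lub (maxF-lub _ (coefficient ∘ xᵛ)) (coefficient yᵛ))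
                        (maxF-lub _ (coefficient ∘ wᵛ)))
              constant

size-polynomial : ∀ {n} → 1 ℕ.≤ n →
  (n ℕ.+ 1 ℕ.+ suc n ℕ.* suc n ℕ.+ 1) ℕ.* (10 ℕ.* (suc n ℕ.* n)) ℕ.* suc (suc n ℕ.+ suc n)
    ℕ.≤ 700 ℕ.* n ℕ.^ 5
size-polynomial {n@(suc p)} _ = ℕₚ.≤-trans
  (ℕₚ.*-mono-≤ (ℕₚ.*-mono-≤ first second) third)
  (ℕₚ.≤-reflexive (product n))
  where
  first : n ℕ.+ 1 ℕ.+ suc n ℕ.* suc n ℕ.+ 1 ℕ.≤ 7 ℕ.* (n ℕ.* n)
  first = ℕₚ.m+n≤o⇒m≤o _ {6 ℕ.* (p ℕ.* p) ℕ.+ 9 ℕ.* p} (ℕₚ.≤-reflexive (slack p))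
    where
    slack : ∀ p → suc p ℕ.+ 1 ℕ.+ suc (suc p) ℕ.* suc (suc p) ℕ.+ 1 ℕ.+ (6 ℕ.* (p ℕ.* p) ℕ.+ 9 ℕ.* p)
                  ≡ 7 ℕ.* (suc p ℕ.* suc p)
    slack = solve-∀
  second : 10 ℕ.* (suc n ℕ.* n) ℕ.≤ 20 ℕ.* (n ℕ.* n)
  second = ℕₚ.m+n≤o⇒m≤o _ {10 ℕ.* (p ℕ.* p) ℕ.+ 10 ℕ.* p} (ℕₚ.≤-reflexive (slack p))
    where
    slack : ∀ p → 10 ℕ.* (suc (suc p) ℕ.* suc p) ℕ.+ (10 ℕ.* (p ℕ.* p) ℕ.+ 10 ℕ.* p)
                  ≡ 20 ℕ.* (suc p ℕ.* suc p)
    slack = solve-∀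
  third : suc (suc n ℕ.+ suc n) ℕ.≤ 5 ℕ.* n
  third = ℕₚ.m+n≤o⇒m≤o _ {3 ℕ.* p} (ℕₚ.≤-reflexive (slack p))
    where
    slack : ∀ p → suc (suc (suc p) ℕ.+ suc (suc p)) ℕ.+ 3 ℕ.* p ≡ 5 ℕ.* suc p
    slack = solve-∀
  -- n ℕ.^ 5 is spelled out because solve-∀ does not accept _^_ here.
  product : ∀ n → 7 ℕ.* (n ℕ.* n) ℕ.* (20 ℕ.* (n ℕ.* n)) ℕ.* (5 ℕ.* n)
                  ≡ 700 ℕ.* (n ℕ.* (n ℕ.* (n ℕ.* (n ℕ.* (n ℕ.* 1)))))
  product = solve-∀

module Program (n : ℕ) (t : ℤ) where

  N : ℕ
  N = suc n

  κ : Fin N → ℤ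
  κ k = ℤ.+ toℕ k

  on-target : Fin N → ℤ
  on-target k = 𝟙 (κ k ℤ.≟ t)

  record Decomposition (x : Fin n → ℚ) (y : ℚ) (μ : Fin N → ℚ) (z : Fin N → Fin n → ℚ) : Set where
    field
      column-sum  : ∀ j → x j ≡ sumℚ (λ k → z k j)
      part-nonneg : ∀ k j → 0ℚ ≤ z k j
      part≤weight : ∀ k j → z k j ≤ μ k
      row-sum     : ∀ k → sumℚ (z k) ≡ fromℤ (κ k) * μ k
      weight-sum  : sumℚ μ ≡ 1ℚ
      output      : y ≡ sumℚ (λ k → fromℤ (on-target k) * μ k)

  decomposition-resp : ∀ {x x′ y μ μ′ z z′} →
    (∀ j → x j ≡ x′ j) → (∀ k → μ k ≡ μ′ k) → (∀ k j → z k j ≡ z′ k j) →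
    Decomposition x y μ z → Decomposition x′ y μ′ z′
  decomposition-resp x≗x′ μ≗μ′ z≗z′ D = record
    { column-sum  = λ j → trans (sym (x≗x′ j)) (trans (column-sum j) (sumℚ-cong λ k → z≗z′ k j))
    ; part-nonneg = λ k j → subst (0ℚ ≤_) (z≗z′ k j) (part-nonneg k j)
    ; part≤weight = λ k j → subst₂ _≤_ (z≗z′ k j) (μ≗μ′ k) (part≤weight k j)
    ; row-sum     = λ k → trans (sumℚ-cong (sym ∘ z≗z′ k))
                                (trans (row-sum k) (cong (fromℤ (κ k) *_) (μ≗μ′ k)))
    ; weight-sum  = trans (sumℚ-cong (sym ∘ μ≗μ′)) weight-sum
    ; output      = trans output (sumℚ-cong λ k → cong (fromℤ (on-target k) *_) (μ≗μ′ k))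
    }
    where open Decomposition D

  decomposition-permute : ∀ {x y μ z} (τ : Permutation′ n) → Decomposition x y μ z →
    Decomposition (λ j → x (τ ⟨$⟩ʳ j)) y μ (λ k j → z k (τ ⟨$⟩ʳ j))
  decomposition-permute {z = z} τ D = record
    { column-sum  = λ j → column-sum (τ ⟨$⟩ʳ j)
    ; part-nonneg = λ k j → part-nonneg k (τ ⟨$⟩ʳ j)
    ; part≤weight = λ k j → part≤weight k (τ ⟨$⟩ʳ j)
    ; row-sum     = λ k → trans (sumℚ-permute τ (z k)) (row-sum k)
    ; weight-sum  = weight-sum
    ; output      = output
    }
    where open Decomposition D

  decomposition-exists : ∀ {x} → Binary x → (m : Fin N) → sumℚ x ≡ fromℤ (κ m) →
    Decomposition x (fromℤ (on-target m)) (λ k → fromℤ (δ m k)) (λ k j → fromℤ (δ m k) * x j)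
  decomposition-exists {x} bin m Σx≡m = record
    { column-sum  = λ j → sym (sumℚ-δ m (λ _ → x j))
    ; part-nonneg = λ k j → 0≤*-Bit (0≤𝟙 (m Finₚ.≟ k)) (bin j)
    ; part≤weight = λ k j → *-Bit-≤ (0≤𝟙 (m Finₚ.≟ k)) (bin j)
    ; row-sum     = λ k → begin
        sumℚ (λ j → fromℤ (δ m k) * x j) ≡⟨ sumℚ-*ˡ (fromℤ (δ m k)) x ⟩
        fromℤ (δ m k) * sumℚ x           ≡⟨ cong (fromℤ (δ m k) *_) Σx≡m ⟩
        fromℤ (δ m k) * fromℤ (κ m)      ≡⟨ sym (fromℤ-* (δ m k) (κ m)) ⟩
        fromℤ (δ m k ℤ.* κ m)            ≡⟨ cong fromℤ (δ-*-comm κ m k) ⟩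
        fromℤ (κ k ℤ.* δ m k)            ≡⟨ fromℤ-* (κ k) (δ m k) ⟩
        fromℤ (κ k) * fromℤ (δ m k)      ∎
    ; weight-sum  = trans (sumℚ-cong λ k → sym (*-identityʳ (fromℤ (δ m k)))) (sumℚ-δ m (λ _ → 1ℚ))
    ; output      = sym (trans (sumℚ-cong λ k → *-comm (fromℤ (on-target k)) (fromℤ (δ m k)))
                               (sumℚ-δ m (fromℤ ∘ on-target)))
    }
    where open ≡-Reasoning

  module _ {x y μ z} (bin : Binary x) (D : Decomposition x y μ z)
           {m : Fin N} (Σx≡m : sumℚ x ≡ fromℤ (κ m)) where
    open Decomposition D

    part≡x*weight : ∀ k j → z k j ≡ x j * μ k
    part≡x*weight k j with bin j
    ... | inj₁ xⱼ≡0 = begin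
      z k j     ≡⟨ sym (≤-pointwise∧sum-≥⇒≡ (λ k → part-nonneg k j) Σz≤0 k) ⟩
      0ℚ        ≡⟨ sym (*-zeroˡ (μ k)) ⟩
      0ℚ * μ k  ≡⟨ cong (_* μ k) (sym xⱼ≡0) ⟩
      x j * μ k ∎
      where
      open ≡-Reasoning
      Σz≤0 : sumℚ (λ k → z k j) ≤ sumℚ {N} (λ _ → 0ℚ)
      Σz≤0 = ≤-reflexive (trans (sym (column-sum j)) (trans xⱼ≡0 (sym (sumℚ-zero N))))
    ... | inj₂ xⱼ≡1 = begin
      z k j     ≡⟨ ≤-pointwise∧sum-≥⇒≡ (λ k → part≤weight k j) Σμ≤Σz k ⟩
      μ k       ≡⟨ sym (*-identityˡ (μ k)) ⟩
      1ℚ * μ k  ≡⟨ cong (_* μ k) (sym xⱼ≡1) ⟩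
      x j * μ k ∎
      where
      open ≡-Reasoning
      Σμ≤Σz : sumℚ μ ≤ sumℚ (λ k → z k j)
      Σμ≤Σz = ≤-reflexive (trans weight-sum (trans (sym xⱼ≡1) (column-sum j)))

    weight-off-level : ∀ k → k ≢ m → μ k ≡ 0ℚ
    weight-off-level k k≢m = *-cancelʳ-≢ (μ k) κk≢κm (begin
      fromℤ (κ k) * μ k      ≡⟨ sym (row-sum k) ⟩
      sumℚ (z k)             ≡⟨ sumℚ-cong (part≡x*weight k) ⟩
      sumℚ (λ j → x j * μ k) ≡⟨ sumℚ-*ʳ (μ k) x ⟩
      sumℚ x * μ k           ≡⟨ cong (_* μ k) Σx≡m ⟩
      fromℤ (κ m) * μ k      ∎)
      where
      open ≡-Reasoning
      κk≢κm : fromℤ (κ k) ≢ fromℤ (κ m)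
      κk≢κm eq = k≢m (Finₚ.toℕ-injective (ℤₚ.+-injective (fromℤ-injective eq)))

    output≡on-target : y ≡ fromℤ (on-target m)
    output≡on-target = begin
      y                                      ≡⟨ output ⟩
      sumℚ (λ k → fromℤ (on-target k) * μ k) ≡⟨ sumℚ-supported _ m off-level ⟩
      fromℤ (on-target m) * μ m              ≡⟨ cong (fromℤ (on-target m) *_) weight-at-level ⟩
      fromℤ (on-target m) * 1ℚ               ≡⟨ *-identityʳ (fromℤ (on-target m)) ⟩
      fromℤ (on-target m)                    ∎
      where
      open ≡-Reasoning
      weight-at-level : μ m ≡ 1ℚ
      weight-at-level = trans (sym (sumℚ-supported μ m weight-off-level)) weight-sum
      off-level : ∀ k → k ≢ m → fromℤ (on-target k) * μ k ≡ 0ℚ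
      off-level k k≢m =
        trans (cong (fromℤ (on-target k) *_) (weight-off-level k k≢m)) (*-zeroʳ (fromℤ (on-target k)))

  #aux : ℕ
  #aux = N ℕ.* N

  #rows : ℕ
  #rows = 10 ℕ.* (N ℕ.* n)

  -- The auxiliary variables form an N × N matrix: column 0 holds the weights, the others the parts.
  weight : (Fin #aux → ℚ) → Fin N → ℚ
  weight w k = w (combine k zero)

  part : (Fin #aux → ℚ) → Fin N → Fin n → ℚ
  part w k j = w (combine k (suc j))

  entry : (Fin N → ℚ) → (Fin N → Fin n → ℚ) → Fin N × Fin N → ℚ
  entry μ z (k , zero)  = μ k
  entry μ z (k , suc j) = z k j

  pack : (Fin N → ℚ) → (Fin N → Fin n → ℚ) → Fin #aux → ℚ
  pack μ z = entry μ z ∘ remQuot N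

  weight-pack : ∀ μ z k → weight (pack μ z) k ≡ μ k
  weight-pack μ z k = cong (entry μ z) (Finₚ.remQuot-combine k zero)

  part-pack : ∀ μ z k j → part (pack μ z) k j ≡ z k j
  part-pack μ z k j = cong (entry μ z) (Finₚ.remQuot-combine k (suc j))

  Λ : Fin N → Form n #aux
  Λ k = W (combine k zero)

  Z : Fin N → Fin n → Form n #aux
  Z k j = W (combine k (suc j))

  -- Constraints not involving k or j are repeated for every (k, j), so that the rows form a product;
  -- reading them back therefore needs some j₀ : Fin n.
  constraint : Fin 10 × Fin N × Fin n → Inequality n #aux
  constraint (0F , k , j) = X j ≼ ∑ (λ k′ → Z k′ j)
  constraint (1F , k , j) = ∑ (λ k′ → Z k′ j) ≼ X j
  constraint (2F , k , j) = 0ᶠ ≼ Z k j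
  constraint (3F , k , j) = Z k j ≼ Λ k
  constraint (4F , k , j) = ∑ (Z k) ≼ κ k · Λ k
  constraint (5F , k , j) = κ k · Λ k ≼ ∑ (Z k)
  constraint (6F , k , j) = ∑ Λ ≼ 𝟏
  constraint (7F , k , j) = 𝟏 ≼ ∑ Λ
  constraint (8F , k , j) = Y ≼ ∑ (λ k′ → on-target k′ · Λ k′)
  constraint (9F , k , j) = ∑ (λ k′ → on-target k′ · Λ k′) ≼ Y

  row-index : Fin #rows ↔ (Fin 10 × Fin N × Fin n)
  row-index = (↔-id (Fin 10) ×-↔ Finₚ.*↔×) ↔-∘ Finₚ.*↔×

  EX : LP n #aux #rows
  EX = system (constraint ∘ Inverse.to row-index)

  module _ (x : Fin n → ℚ) (y : ℚ) (w : Fin #aux → ℚ) where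

    ⟦Λ⟧ : ∀ k → ⟦ Λ k ⟧ x y w ≡ weight w k
    ⟦Λ⟧ k = ⟦W⟧ x y w (combine k zero)

    ⟦Z⟧ : ∀ k j → ⟦ Z k j ⟧ x y w ≡ part w k j
    ⟦Z⟧ k j = ⟦W⟧ x y w (combine k (suc j))

    ⟦column⟧ : ∀ j → ⟦ ∑ (λ k → Z k j) ⟧ x y w ≡ sumℚ (λ k → part w k j)
    ⟦column⟧ j = trans (⟦∑⟧ x y w (λ k → Z k j)) (sumℚ-cong λ k → ⟦Z⟧ k j)

    ⟦row⟧ : ∀ k → ⟦ ∑ (Z k) ⟧ x y w ≡ sumℚ (part w k)
    ⟦row⟧ k = trans (⟦∑⟧ x y w (Z k)) (sumℚ-cong (⟦Z⟧ k))

    ⟦total⟧ : ⟦ ∑ Λ ⟧ x y w ≡ sumℚ (weight w)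
    ⟦total⟧ = trans (⟦∑⟧ x y w Λ) (sumℚ-cong ⟦Λ⟧)

    ⟦level⟧ : ∀ k → ⟦ κ k · Λ k ⟧ x y w ≡ fromℤ (κ k) * weight w k
    ⟦level⟧ k = trans (⟦·⟧ x y w (κ k) (Λ k)) (cong (fromℤ (κ k) *_) (⟦Λ⟧ k))

    ⟦output⟧ : ⟦ ∑ (λ k → on-target k · Λ k) ⟧ x y w ≡ sumℚ (λ k → fromℤ (on-target k) * weight w k)
    ⟦output⟧ = trans (⟦∑⟧ x y w (λ k → on-target k · Λ k)) (sumℚ-cong λ k →
      trans (⟦·⟧ x y w (on-target k) (Λ k)) (cong (fromℤ (on-target k) *_) (⟦Λ⟧ k)))

    reading : ∀ {P Q p q} → ⟦ P ⟧ x y w ≡ p → ⟦ Q ⟧ x y w ≡ q → Holds (P ≼ Q) x y w ⇔ p ≤ q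
    reading ⟦P⟧≡p ⟦Q⟧≡q = mk⇔ (λ { (holds P≤Q) → subst₂ _≤_ ⟦P⟧≡p ⟦Q⟧≡q P≤Q })
                              (holds ∘ subst₂ _≤_ (sym ⟦P⟧≡p) (sym ⟦Q⟧≡q))

    holds⇔decomposition : Fin n →
      (∀ i → Holds (constraint i) x y w) ⇔ Decomposition x y (weight w) (part w)
    holds⇔decomposition j₀ = mk⇔ decompose satisfy
      where
      decompose : (∀ i → Holds (constraint i) x y w) → Decomposition x y (weight w) (part w)
      decompose H = record
        { column-sum  = λ j → ≤-antisym (to (reading (⟦X⟧ x y w j) (⟦column⟧ j)) (H (0F , zero , j)))
                                        (to (reading (⟦column⟧ j) (⟦X⟧ x y w j)) (H (1F , zero , j)))
        ; part-nonneg = λ k j → to (reading (⟦0ᶠ⟧ x y w) (⟦Z⟧ k j)) (H (2F , k , j))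
        ; part≤weight = λ k j → to (reading (⟦Z⟧ k j) (⟦Λ⟧ k)) (H (3F , k , j))
        ; row-sum     = λ k → ≤-antisym (to (reading (⟦row⟧ k) (⟦level⟧ k)) (H (4F , k , j₀)))
                                        (to (reading (⟦level⟧ k) (⟦row⟧ k)) (H (5F , k , j₀)))
        ; weight-sum  = ≤-antisym (to (reading ⟦total⟧ (⟦𝟏⟧ x y w)) (H (6F , zero , j₀)))
                                  (to (reading (⟦𝟏⟧ x y w) ⟦total⟧) (H (7F , zero , j₀)))
        ; output      = ≤-antisym (to (reading (⟦Y⟧ x y w) ⟦output⟧) (H (8F , zero , j₀)))
                                  (to (reading ⟦output⟧ (⟦Y⟧ x y w)) (H (9F , zero , j₀)))
        }

      satisfy : Decomposition x y (weight w) (part w) → ∀ i → Holds (constraint i) x y w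
      satisfy D = holds-at
        where
        open Decomposition D
        holds-at : ∀ i → Holds (constraint i) x y w
        holds-at (0F , k , j) = from (reading (⟦X⟧ x y w j) (⟦column⟧ j)) (≤-reflexive (column-sum j))
        holds-at (1F , k , j) = from (reading (⟦column⟧ j) (⟦X⟧ x y w j)) (≤-reflexive (sym (column-sum j)))
        holds-at (2F , k , j) = from (reading (⟦0ᶠ⟧ x y w) (⟦Z⟧ k j)) (part-nonneg k j)
        holds-at (3F , k , j) = from (reading (⟦Z⟧ k j) (⟦Λ⟧ k)) (part≤weight k j)
        holds-at (4F , k , j) = from (reading (⟦row⟧ k) (⟦level⟧ k)) (≤-reflexive (row-sum k))
        holds-at (5F , k , j) = from (reading (⟦level⟧ k) (⟦row⟧ k)) (≤-reflexive (sym (row-sum k)))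
        holds-at (6F , k , j) = from (reading ⟦total⟧ (⟦𝟏⟧ x y w)) (≤-reflexive weight-sum)
        holds-at (7F , k , j) = from (reading (⟦𝟏⟧ x y w) ⟦total⟧) (≤-reflexive (sym weight-sum))
        holds-at (8F , k , j) = from (reading (⟦Y⟧ x y w) ⟦output⟧) (≤-reflexive output)
        holds-at (9F , k , j) = from (reading ⟦output⟧ (⟦Y⟧ x y w)) (≤-reflexive (sym output))

    feasible⇔decomposition : Fin n → Feasible EX x y w ⇔ Decomposition x y (weight w) (part w)
    feasible⇔decomposition j₀ = holds⇔decomposition j₀ ⇔-∘
      (∀-↔ row-index ⇔-∘ feasible⇔holds x y w (constraint ∘ Inverse.to row-index))

  lift-aux : Permutation′ n → Permutation′ #aux
  lift-aux τ = ↔-sym Finₚ.*↔× ↔-∘ ((↔-id (Fin N) ×-↔ lift₀ τ) ↔-∘ Finₚ.*↔×)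

  lift-aux-combine : ∀ τ k j′ → lift-aux τ ⟨$⟩ʳ combine k j′ ≡ combine k (lift₀ τ ⟨$⟩ʳ j′)
  lift-aux-combine τ k j′ = cong shift (Finₚ.remQuot-combine k j′)
    where
    shift : Fin N × Fin N → Fin #aux
    shift (k , j) = combine k (lift₀ τ ⟨$⟩ʳ j)

  EX-symmetric : Fin n → (τ : Permutation′ n) → Σ (Permutation′ #aux) λ σ →
    (x : Fin n → ℚ) (y : ℚ) (w : Fin #aux → ℚ) →
    Feasible EX x y w ⇔ Feasible EX (λ j → x (τ ⟨$⟩ʳ j)) y (λ p → w (σ ⟨$⟩ʳ p))
  EX-symmetric j₀ τ = σ , λ x y w →
    let x∘τ = λ j → x (τ ⟨$⟩ʳ j)
        w∘σ = λ p → w (σ ⟨$⟩ʳ p)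
    in mk⇔
      (λ feasible → from (feasible⇔decomposition x∘τ y w∘σ j₀)
        (decomposition-resp (λ _ → refl) (sym ∘ weight-σ w) (λ k j → sym (part-σ w k j))
          (decomposition-permute τ (to (feasible⇔decomposition x y w j₀) feasible))))
      (λ feasible → from (feasible⇔decomposition x y w j₀)
        (decomposition-resp (λ j → cong x (Perm.inverseʳ τ)) (weight-σ w)
          (λ k j → trans (part-σ w k (Perm.flip τ ⟨$⟩ʳ j)) (cong (part w k) (Perm.inverseʳ τ)))
          (decomposition-permute (Perm.flip τ) (to (feasible⇔decomposition x∘τ y w∘σ j₀) feasible))))
    where
    σ = lift-aux τ
    weight-σ : ∀ w k → weight (λ p → w (σ ⟨$⟩ʳ p)) k ≡ weight w k
    weight-σ w k = cong w (lift-aux-combine τ k zero)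
    part-σ : ∀ w k j → part (λ p → w (σ ⟨$⟩ʳ p)) k j ≡ part w k (τ ⟨$⟩ʳ j)
    part-σ w k j = cong w (lift-aux-combine τ k (suc j))

  module _ (j₀ : Fin n) {x : Fin n → ℚ} (bin : Binary x)
           {m : Fin N} (Σx≡m : sumℚ x ≡ fromℤ (κ m)) where

    EX-extendable : Extendable EX x (fromℤ (on-target m))
    EX-extendable = pack μ z , from (feasible⇔decomposition x (fromℤ (on-target m)) (pack μ z) j₀)
      (decomposition-resp (λ _ → refl) (sym ∘ weight-pack μ z) (λ k j → sym (part-pack μ z k j))
        (decomposition-exists bin m Σx≡m))
      where
      μ : Fin N → ℚ
      μ k = fromℤ (δ m k)
      z : Fin N → Fin n → ℚ
      z k j = fromℤ (δ m k) * x j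

    EX-output-unique : (y : ℚ) → Extendable EX x y → y ≡ fromℤ (on-target m)
    EX-output-unique y (w , feasible) =
      output≡on-target bin (to (feasible⇔decomposition x y w j₀) feasible) Σx≡m

  on-target-indicator : ∀ {x : Fin n → ℚ} {m} → sumℚ x ≡ fromℤ (κ m) →
    (sumℚ x ≡ t / 1 → fromℤ (on-target m) ≡ 1ℚ) × (sumℚ x ≢ t / 1 → fromℤ (on-target m) ≡ 0ℚ)
  on-target-indicator {x} {m} Σx≡m =
    cong fromℤ ∘ 𝟙-yes (κ m ℤ.≟ t) ∘ to Σx≡t⇔κm≡t ,
    λ Σx≢t → cong fromℤ (𝟙-no (κ m ℤ.≟ t) (Σx≢t ∘ from Σx≡t⇔κm≡t))
    where
    Σx≡t⇔κm≡t : sumℚ x ≡ t / 1 ⇔ κ m ≡ t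
    Σx≡t⇔κm≡t = mk⇔
      (λ Σx≡t → fromℤ-injective (trans (sym Σx≡m) (trans Σx≡t (sym (fromℤ≡/1 t)))))
      (λ κm≡t → trans Σx≡m (trans (cong fromℤ κm≡t) (fromℤ≡/1 t)))

  EX-output : Fin n → (x : Fin n → ℚ) → Binary x →
    Σ ℚ λ y → Extendable EX x y
      × ((y′ : ℚ) → Extendable EX x y′ → y′ ≡ y)
      × (sumℚ x ≡ t / 1 → y ≡ 1ℚ)
      × (sumℚ x ≢ t / 1 → y ≡ 0ℚ)
  EX-output j₀ x bin = fromℤ (on-target m) ,
    EX-extendable j₀ bin Σx≡m , EX-output-unique j₀ bin Σx≡m , on-target-indicator Σx≡m
    where
    m = proj₁ (binary-sum x bin)
    Σx≡m = proj₂ (binary-sum x bin)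

  1≤N : 1 ℕ.≤ N
  1≤N = ℕ.s≤s ℕ.z≤n

  Bounded-Λ : ∀ k → Bounded 1 (Λ k)
  Bounded-Λ k = Bounded-W (combine k zero)

  Bounded-Z : ∀ k j → Bounded 1 (Z k j)
  Bounded-Z k j = Bounded-W (combine k (suc j))

  Bounded-column : ∀ j → Bounded N (∑ (λ k → Z k j))
  Bounded-column j = Bounded-∑₁ (λ k → Bounded-Z k j)

  Bounded-row : ∀ k → Bounded N (∑ (Z k))
  Bounded-row k = Bounded-mono (ℕₚ.n≤1+n n) (Bounded-∑₁ (Bounded-Z k))

  Bounded-level : ∀ k → Bounded N (κ k · Λ k)
  Bounded-level k = Bounded-mono
    (ℕₚ.≤-trans (ℕₚ.≤-reflexive (ℕₚ.*-identityʳ (toℕ k))) (ℕₚ.<⇒≤ (Finₚ.toℕ<n k)))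
    (Bounded-· (κ k) (Bounded-Λ k))

  Bounded-total : Bounded N (∑ Λ)
  Bounded-total = Bounded-∑₁ Bounded-Λ

  Bounded-output : Bounded N (∑ (λ k → on-target k · Λ k))
  Bounded-output = Bounded-∑₁ λ k → Bounded-mono
    (ℕₚ.≤-trans (ℕₚ.≤-reflexive (ℕₚ.*-identityʳ ℤ.∣ on-target k ∣)) (∣𝟙∣≤1 (κ k ℤ.≟ t)))
    (Bounded-· (on-target k) (Bounded-Λ k))

  constraint-bounded : ∀ i → Bounded (N ℕ.+ N) (difference (constraint i))
  constraint-bounded (0F , k , j) = Bounded-difference (Bounded-mono 1≤N (Bounded-X j)) (Bounded-column j)
  constraint-bounded (1F , k , j) = Bounded-difference (Bounded-column j) (Bounded-mono 1≤N (Bounded-X j))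
  constraint-bounded (2F , k , j) =
    Bounded-difference (Bounded-mono (ℕ.z≤n {N}) Bounded-0ᶠ) (Bounded-mono 1≤N (Bounded-Z k j))
  constraint-bounded (3F , k , j) =
    Bounded-difference (Bounded-mono 1≤N (Bounded-Z k j)) (Bounded-mono 1≤N (Bounded-Λ k))
  constraint-bounded (4F , k , j) = Bounded-difference (Bounded-row k) (Bounded-level k)
  constraint-bounded (5F , k , j) = Bounded-difference (Bounded-level k) (Bounded-row k)
  constraint-bounded (6F , k , j) = Bounded-difference Bounded-total (Bounded-mono 1≤N Bounded-𝟏)
  constraint-bounded (7F , k , j) = Bounded-difference (Bounded-mono 1≤N Bounded-𝟏) Bounded-total
  constraint-bounded (8F , k , j) = Bounded-difference (Bounded-mono 1≤N Bounded-Y) Bounded-output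
  constraint-bounded (9F , k , j) = Bounded-difference Bounded-output (Bounded-mono 1≤N Bounded-Y)

  EX-size : 1 ℕ.≤ n → size EX ℕ.≤ 700 ℕ.* n ℕ.^ 5
  EX-size 1≤n = ℕₚ.≤-trans
    (ℕₚ.*-monoʳ-≤ ((n ℕ.+ 1 ℕ.+ #aux ℕ.+ 1) ℕ.* #rows)
      (maxBits-system (constraint ∘ Inverse.to row-index) (constraint-bounded ∘ Inverse.to row-index)))
    (size-polynomial 1≤n)

lemma3p2 : Σ ℕ λ c → Σ ℕ λ d →
  (n : ℕ) → 1 ℕ.≤ n → (t : ℤ) →
  Σ ℕ λ a → Σ ℕ λ r → Σ (LP n a r) λ EX →
    (size EX ℕ.≤ c ℕ.* n ℕ.^ d)
    × ((τ : Permutation′ n) → Σ (Permutation′ a) λ σ →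
         (x : Fin n → ℚ) (y : ℚ) (w : Fin a → ℚ) →
           Feasible EX x y w ⇔ Feasible EX (λ j → x (τ ⟨$⟩ʳ j)) y (λ k → w (σ ⟨$⟩ʳ k)))
    × ((x : Fin n → ℚ) → (∀ j → (x j ≡ 0ℚ) ⊎ (x j ≡ 1ℚ)) →
         Σ ℚ λ y → Extendable EX x y
           × ((y′ : ℚ) → Extendable EX x y′ → y′ ≡ y)
           × (sumℚ x ≡ t / 1 → y ≡ 1ℚ)
           × (sumℚ x ≢ t / 1 → y ≡ 0ℚ))
lemma3p2 = 700 , 5 , λ n 1≤n t →
  let open Program n t
      j₀ = fromℕ< 1≤n
  in #aux , #rows , EX , EX-size 1≤n , EX-symmetric j₀ , EX-output j₀
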